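{- Let $v_1\ge2$ and $v_2\ge1$ be integers, $\mathbf{v}=(v_1,v_2)$ and $\mathbf{k}=(2,1)$. Then there exists a $2$-$(\mathbf{v},\mathbf{k},1)$ generalized packing with exactly $\min\left\{\binom{v_1}{2},\ v_2\lfloor v_1/2\rfloor\right\}$ blocks.
   Context: Let $X_1,X_2$ be disjoint sets with $|X_1|=v_1$, $|X_2|=v_2$. A block is a pair $(B_1,\{x\})$ with $B_1$ a $2$-subset of $X_1$ and $x\in X_2$. A $2$-$((v_1,v_2),(2,1),1)$ generalized packing is a family of blocks such that no $2$-subset of $X_1$ occurs as $B_1$ in more than one block, and for each $a\in X_1$, $x\in X_2$ at most one block $(B_1,\{x\})$ has $a\in B_1$. -}

module Defs where

open import Data.Nat using (ℕ)
open import Data.Fin using (Fin; _<_)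
open import Data.List using (List)
open import Data.List.Membership.Propositional using (_∈_)
open import Data.List.Relation.Unary.Unique.Propositional using (Unique)
open import Data.Product using (_×_)
open import Data.Sum using (_⊎_)
open import Relation.Binary.PropositionalEquality using (_≡_)

-- A block (B₁, {x}) with B₁ = {lo, hi} a 2-subset of X₁ = Fin v₁
-- (represented canonically with lo < hi) and x ∈ X₂ = Fin v₂.
record Block (v₁ v₂ : ℕ) : Set where
  constructor block
  field
    lo    : Fin v₁
    hi    : Fin v₁
    lo<hi : lo < hi
    pt    : Fin v₂
open Block public

_∈B₁_ : ∀ {v₁ v₂} → Fin v₁ → Block v₁ v₂ → Set
a ∈B₁ β = (a ≡ lo β) ⊎ (a ≡ hi β)

SamePair : ∀ {v₁ v₂} → Block v₁ v₂ → Block v₁ v₂ → Set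
SamePair β γ = (lo β ≡ lo γ) × (hi β ≡ hi γ)

record IsGeneralizedPacking {v₁ v₂ : ℕ} (P : List (Block v₁ v₂)) : Set where
  field
    distinct  : Unique P
    pairOnce  : ∀ {β γ} → β ∈ P → γ ∈ P → SamePair β γ → β ≡ γ
    pointOnce : ∀ {β γ} (a : Fin v₁) → β ∈ P → γ ∈ P →
                pt β ≡ pt γ → a ∈B₁ β → a ∈B₁ γ → β ≡ γ

-- Write M = 2k+1.  The round-robin 1-factorisation of the complete graph on
-- ℤ_M ∪ {∞} colours the edge {x,y} of ℤ_M with the colour c satisfying
-- x + y ≡ 2c (mod M), and the edge {c,∞} with colour c.  Colour classes are
-- (near-)perfect matchings, so using the point c ∈ X₂ as the colour c turns
-- every coloured edge with c < v₂ into a block, and these blocks form a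
-- packing: the colour of a pair is unique (2 is invertible modulo M) and so
-- is the partner of a vertex in a given colour (translations are invertible).
--
-- It then lists the k edges
-- of every colour class c < min(v₂, M), plus the edge {c,∞} when v₁ = M+1,
-- giving min(v₂, M)·⌊v₁/2⌋ blocks; a binomial computation identifies this
-- number with the one in the statement.
module Submission where

open import Defs
open import Data.Nat using (ℕ; _≥_; _⊓_; _*_; _/_)
open import Data.Nat.Combinatorics using (_C_)
open import Data.List using (List; length)
open import Data.Product using (Σ; _×_)
open import Relation.Binary.PropositionalEquality using (_≡_)

open import Data.Nat using (zero; suc; _+_; _∸_; _%_; _<_; _≤_; z≤n; s≤s; NonZero)
open import Data.Nat.Properties
open import Data.Nat.DivMod
open import Data.Nat.Divisibility using (divides-refl)
open import Data.Nat.Combinatorics using (nC1≡n; nCk+nC[k+1]≡[n+1]C[k+1])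
open import Data.Nat.Tactic.RingSolver using (solve-∀)
open import Data.Fin as Fin using (Fin; toℕ; fromℕ<; remQuot; combine)
open import Data.Fin.Properties using (toℕ-injective; toℕ<n; toℕ-fromℕ<; combine-remQuot)
open import Data.List using (map; allFin)
open import Data.List.Properties using (length-map; length-tabulate)
open import Data.List.Membership.Propositional using (_∈_)
open import Data.List.Membership.Propositional.Properties using (∈-map⁻)
open import Data.List.Relation.Unary.Unique.Propositional.Properties using (map⁺; allFin⁺)
open import Data.Product using (_,_; proj₁; proj₂)
open import Data.Sum using (_⊎_; inj₁; inj₂)
open import Data.Empty using (⊥-elim)
open import Function using (_∘_; id)
open import Relation.Binary using (tri<; tri≈; tri>)
open import Relation.Binary.PropositionalEquality
  using (_≢_; refl; sym; trans; cong; cong₂; subst; subst₂; module ≡-Reasoning)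

%-absorbˡ-+ : ∀ m n d .{{_ : NonZero d}} → (m % d + n) % d ≡ (m + n) % d
%-absorbˡ-+ m n d = begin
  (m % d + n) % d          ≡⟨ %-distribˡ-+ (m % d) n d ⟩
  (m % d % d + n % d) % d  ≡⟨ cong (λ z → (z + n % d) % d) (m%n%n≡m%n m d) ⟩
  (m % d + n % d) % d      ≡⟨ %-distribˡ-+ m n d ⟨
  (m + n) % d              ∎
  where open ≡-Reasoning

%-absorbˡ-* : ∀ m n d .{{_ : NonZero d}} → (m % d * n) % d ≡ (m * n) % d
%-absorbˡ-* m n d = begin
  (m % d * n) % d           ≡⟨ %-distribˡ-* (m % d) n d ⟩
  (m % d % d * (n % d)) % d ≡⟨ cong (λ z → (z * (n % d)) % d) (m%n%n≡m%n m d) ⟩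
  (m % d * (n % d)) % d     ≡⟨ %-distribˡ-* m n d ⟨
  (m * n) % d               ∎
  where open ≡-Reasoning

residue-injective : ∀ {d} .{{_ : NonZero d}} (f g : ℕ → ℕ) →
  (∀ u → g (f u % d) ≡ u % d) →
  ∀ {t s} → t < d → s < d → f t % d ≡ f s % d → t ≡ s
residue-injective {d} f g g∘f {t} {s} t<d s<d eq = begin
  t            ≡⟨ m<n⇒m%n≡m t<d ⟨
  t % d        ≡⟨ g∘f t ⟨
  g (f t % d)  ≡⟨ cong g eq ⟩
  g (f s % d)  ≡⟨ g∘f s ⟩
  s % d        ≡⟨ m<n⇒m%n≡m s<d ⟩
  s            ∎
  where open ≡-Reasoning

-- Translation by a is injective modulo d: it is undone by adding d ∸ a % d.
translate-cancel : ∀ a {d} .{{_ : NonZero d}} {t s} → t < d → s < d →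
  (a + t) % d ≡ (a + s) % d → t ≡ s
translate-cancel a {d} = residue-injective (a +_) untranslate untranslate∘translate
  where
  r = a % d
  untranslate : ℕ → ℕ
  untranslate z = (z + (d ∸ r)) % d
  untranslate∘translate : ∀ u → untranslate ((a + u) % d) ≡ u % d
  untranslate∘translate u = begin
    ((a + u) % d + (d ∸ r)) % d         ≡⟨ %-absorbˡ-+ (a + u) (d ∸ r) d ⟩
    (a + u + (d ∸ r)) % d               ≡⟨ cong (λ z → (z + u + (d ∸ r)) % d) (m≡m%n+[m/n]*n a d) ⟩
    (r + a / d * d + u + (d ∸ r)) % d   ≡⟨ cong (_% d) (rearrange r (a / d * d) u (d ∸ r)) ⟩
    (u + (r + (d ∸ r)) + a / d * d) % d ≡⟨ cong (λ z → (u + z + a / d * d) % d) (m+[n∸m]≡n (m%n≤n a d)) ⟩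
    (u + d + a / d * d) % d             ≡⟨ [m+kn]%n≡m%n (u + d) (a / d) d ⟩
    (u + d) % d                         ≡⟨ [m+n]%n≡m%n u d ⟩
    u % d                               ∎
    where
    open ≡-Reasoning
    rearrange : ∀ p q x y → p + q + x + y ≡ x + (p + y) + q
    rearrange = solve-∀

-- Doubling is injective modulo an odd number 2k+1: it is undone by
-- multiplying with k+1, since 2(k+1) ≡ 1.
double-cancel : ∀ k {t s} → t < suc (k + k) → s < suc (k + k) →
  (t + t) % suc (k + k) ≡ (s + s) % suc (k + k) → t ≡ s
double-cancel k = residue-injective (λ u → u + u) halve halve∘double
  where
  d = suc (k + k)
  halve : ℕ → ℕ
  halve z = (z * suc k) % d
  halve∘double : ∀ u → halve ((u + u) % d) ≡ u % d
  halve∘double u = begin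
    ((u + u) % d * suc k) % d ≡⟨ %-absorbˡ-* (u + u) (suc k) d ⟩
    ((u + u) * suc k) % d     ≡⟨ cong (_% d) (expand u k) ⟩
    (u + u * d) % d           ≡⟨ [m+kn]%n≡m%n u u d ⟩
    u % d                     ∎
    where
    open ≡-Reasoning
    expand : ∀ u k → (u + u) * suc k ≡ u + u * suc (k + k)
    expand = solve-∀

module _ {n v : ℕ} where

  block-≡ : {β γ : Block n v} → SamePair β γ → pt β ≡ pt γ → β ≡ γ
  block-≡ {block l h l<h x} {block .l .h l<h′ .x} (refl , refl) refl =
    cong (λ p → block l h p x) (<-irrelevant l<h l<h′)

  other : ∀ {a} (β : Block n v) → a ∈B₁ β → Fin n
  other β (inj₁ _) = hi β
  other β (inj₂ _) = lo β

  -- Two blocks through a with the same second element of B₁ have the same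
  -- pair; a cannot be the smaller element of one and the larger of the other
  -- because that would give lo β < hi β = lo γ < hi γ = lo β.
  same-pair-from-other : ∀ {a} {β γ : Block n v} (aβ : a ∈B₁ β) (aγ : a ∈B₁ γ) →
    other β aβ ≡ other γ aγ → SamePair β γ
  same-pair-from-other (inj₁ refl) (inj₁ a≡lo) eq = a≡lo , eq
  same-pair-from-other (inj₂ refl) (inj₂ a≡hi) eq = eq , a≡hi
  same-pair-from-other {β = β} {γ} (inj₁ refl) (inj₂ lo≡hi) eq = ⊥-elim (<-irrefl refl (begin-strict
    toℕ (lo β) <⟨ lo<hi β ⟩
    toℕ (hi β) ≡⟨ cong toℕ eq ⟩
    toℕ (lo γ) <⟨ lo<hi γ ⟩
    toℕ (hi γ) ≡⟨ cong toℕ lo≡hi ⟨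
    toℕ (lo β) ∎))
    where open ≤-Reasoning
  same-pair-from-other {β = β} {γ} (inj₂ refl) (inj₁ hi≡lo) eq = ⊥-elim (<-irrefl refl (begin-strict
    toℕ (lo γ) <⟨ lo<hi γ ⟩
    toℕ (hi γ) ≡⟨ cong toℕ eq ⟨
    toℕ (lo β) <⟨ lo<hi β ⟩
    toℕ (hi β) ≡⟨ cong toℕ hi≡lo ⟩
    toℕ (lo γ) ∎))
    where open ≤-Reasoning

data Spans {n v} (β : Block n v) (x y : ℕ) : Set where
  forward  : toℕ (lo β) ≡ x → toℕ (hi β) ≡ y → Spans β x y
  backward : toℕ (lo β) ≡ y → toℕ (hi β) ≡ x → Spans β x y

spans-shared : ∀ {n v} {β : Block n v} {x y x′ y′} →
  Spans β x y → Spans β x′ y′ → x ≡ x′ ⊎ x ≡ y′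
spans-shared (forward  l _) (forward  l′ _) = inj₁ (trans (sym l) l′)
spans-shared (forward  l _) (backward l′ _) = inj₂ (trans (sym l) l′)
spans-shared (backward _ h) (forward  _ h′) = inj₂ (trans (sym h) h′)
spans-shared (backward _ h) (backward _ h′) = inj₁ (trans (sym h) h′)

pairBlock : ∀ {n v} (x y : ℕ) → x < n → y < n → x ≢ y → Fin v → Block n v
pairBlock x y x<n y<n x≢y p with <-cmp x y
... | tri< x<y _ _ = block (fromℕ< x<n) (fromℕ< y<n)
        (subst₂ _<_ (sym (toℕ-fromℕ< x<n)) (sym (toℕ-fromℕ< y<n)) x<y) p
... | tri≈ _ x≡y _ = ⊥-elim (x≢y x≡y)
... | tri> _ _ y<x = block (fromℕ< y<n) (fromℕ< x<n)
        (subst₂ _<_ (sym (toℕ-fromℕ< y<n)) (sym (toℕ-fromℕ< x<n)) y<x) p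

pairBlock-spec : ∀ {n v} x y (x<n : x < n) (y<n : y < n) (x≢y : x ≢ y) (p : Fin v) →
  Spans (pairBlock x y x<n y<n x≢y p) x y × pt (pairBlock x y x<n y<n x≢y p) ≡ p
pairBlock-spec x y x<n y<n x≢y p with <-cmp x y
... | tri< _ _ _   = forward (toℕ-fromℕ< x<n) (toℕ-fromℕ< y<n) , refl
... | tri≈ _ x≡y _ = ⊥-elim (x≢y x≡y)
... | tri> _ _ _   = backward (toℕ-fromℕ< y<n) (toℕ-fromℕ< x<n) , refl

Packing : ℕ → ℕ → ℕ → Set
Packing v₁ v₂ size =
  Σ (List (Block v₁ v₂)) λ P → IsGeneralizedPacking P × length P ≡ size

module RoundRobin (k : ℕ) where

  -- The finite vertices are 0, …, M-1; the vertex ∞ is represented by M.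
  M : ℕ
  M = suc (k + k)

  -- Edge c x y: {x, y} is an edge of colour c in the round-robin
  -- 1-factorisation of the complete graph on ℤ_M ∪ {∞}.
  data Edge : ℕ → ℕ → ℕ → Set where
    finite       : ∀ {c x y} → c < M → x < M → y < M → x ≢ y →
                   (x + y) % M ≡ (c + c) % M → Edge c x y
    toInfinity   : ∀ {c} → Edge c c M
    fromInfinity : ∀ {c} → Edge c M c

  edge-sym : ∀ {c x y} → Edge c x y → Edge c y x
  edge-sym {x = x} {y} (finite c<M x<M y<M x≢y sum) =
    finite c<M y<M x<M (x≢y ∘ sym) (trans (cong (_% M) (+-comm y x)) sum)
  edge-sym toInfinity   = fromInfinity
  edge-sym fromInfinity = toInfinity

  -- An edge has at most one colour (doubling is injective modulo M).
  colour-unique : ∀ {c c′ x y} → Edge c x y → Edge c′ x y → c ≡ c′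
  colour-unique (finite c<M _ _ _ sum) (finite c′<M _ _ _ sum′) =
    double-cancel k c<M c′<M (trans (sym sum) sum′)
  colour-unique (finite _ _ y<M _ _) toInfinity   = ⊥-elim (<-irrefl refl y<M)
  colour-unique (finite _ x<M _ _ _) fromInfinity = ⊥-elim (<-irrefl refl x<M)
  colour-unique toInfinity   (finite _ _ y<M _ _) = ⊥-elim (<-irrefl refl y<M)
  colour-unique toInfinity   toInfinity           = refl
  colour-unique toInfinity   fromInfinity         = refl
  colour-unique fromInfinity (finite _ x<M _ _ _) = ⊥-elim (<-irrefl refl x<M)
  colour-unique fromInfinity toInfinity           = refl
  colour-unique fromInfinity fromInfinity         = refl

  -- Every vertex has at most one partner in each colour (translation is
  -- injective modulo M; a finite edge {c, b} of colour c would force b ≡ c).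
  partner-unique : ∀ {c a b b′} → Edge c a b → Edge c a b′ → b ≡ b′
  partner-unique {a = a} (finite _ _ b<M _ sum) (finite _ _ b′<M _ sum′) =
    translate-cancel a b<M b′<M (trans sum (sym sum′))
  partner-unique (finite _ a<M _ _ _) fromInfinity = ⊥-elim (<-irrefl refl a<M)
  partner-unique {c} (finite _ c<M b<M c≢b sum) toInfinity =
    ⊥-elim (c≢b (sym (translate-cancel c b<M c<M sum)))
  partner-unique {c} toInfinity (finite _ c<M b′<M c≢b′ sum) =
    ⊥-elim (c≢b′ (translate-cancel c c<M b′<M (sym sum)))
  partner-unique toInfinity   toInfinity   = refl
  partner-unique toInfinity   fromInfinity = refl
  partner-unique fromInfinity (finite _ a<M _ _ _) = ⊥-elim (<-irrefl refl a<M)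
  partner-unique fromInfinity toInfinity   = refl
  partner-unique fromInfinity fromInfinity = refl

  Coloured : ∀ {n v} → Block n v → Set
  Coloured β = Edge (toℕ (pt β)) (toℕ (lo β)) (toℕ (hi β))

  edge-at : ∀ {n v a} (β : Block n v) → Coloured β → (aβ : a ∈B₁ β) →
    Edge (toℕ (pt β)) (toℕ a) (toℕ (other β aβ))
  edge-at β e (inj₁ refl) = e
  edge-at β e (inj₂ refl) = edge-sym e

  coloured-pairOnce : ∀ {n v} {β γ : Block n v} → Coloured β → Coloured γ →
    SamePair β γ → β ≡ γ
  coloured-pairOnce {β = block l h _ _} {block .l .h _ _} eβ eγ (refl , refl) =
    block-≡ (refl , refl) (toℕ-injective (colour-unique eβ eγ))

  coloured-pointOnce : ∀ {n v} {β γ : Block n v} a → Coloured β → Coloured γ →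
    pt β ≡ pt γ → a ∈B₁ β → a ∈B₁ γ → β ≡ γ
  coloured-pointOnce {β = β} {γ} a eβ eγ pt≡ aβ aγ =
    block-≡ (same-pair-from-other aβ aγ (toℕ-injective partners≡)) pt≡
    where
    partners≡ : toℕ (other β aβ) ≡ toℕ (other γ aγ)
    partners≡ = partner-unique (edge-at β eβ aβ)
      (subst (λ p → Edge (toℕ p) (toℕ a) (toℕ (other γ aγ))) (sym pt≡) (edge-at γ eγ aγ))

  family-packing : ∀ {n v} C s (h : Fin C × Fin s → Block n v) →
    (∀ {i j} → h i ≡ h j → i ≡ j) → (∀ i → Coloured (h i)) → Packing n v (C * s)
  family-packing C s h h-injective h-coloured = P , packing , length-P
    where
    g = h ∘ remQuot s
    g-injective : ∀ {i j} → g i ≡ g j → i ≡ j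
    g-injective {i} {j} e = begin
      i                              ≡⟨ combine-remQuot {C} s i ⟨
      uncurried-combine (remQuot s i) ≡⟨ cong uncurried-combine (h-injective e) ⟩
      uncurried-combine (remQuot s j) ≡⟨ combine-remQuot {C} s j ⟩
      j                              ∎
      where
      open ≡-Reasoning
      uncurried-combine : Fin C × Fin s → Fin (C * s)
      uncurried-combine (x , y) = combine x y
    P = map g (allFin (C * s))
    member-coloured : ∀ {β} → β ∈ P → Coloured β
    member-coloured β∈P with ∈-map⁻ g β∈P
    ... | i , _ , refl = h-coloured (remQuot s i)
    packing : IsGeneralizedPacking P
    packing = record
      { distinct  = map⁺ g-injective (allFin⁺ (C * s))
      ; pairOnce  = λ β∈P γ∈P → coloured-pairOnce (member-coloured β∈P) (member-coloured γ∈P)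
      ; pointOnce = λ a β∈P γ∈P →
          coloured-pointOnce a (member-coloured β∈P) (member-coloured γ∈P)
      }
    length-P : length P ≡ C * s
    length-P = trans (length-map g (allFin (C * s))) (length-tabulate id)

  spans-coloured : ∀ {n v c x y} {β : Block n v} → Spans β x y →
    toℕ (pt β) ≡ c → Edge c x y → Coloured β
  spans-coloured {β = β} (forward l h) p e =
    subst (λ z → Edge z (toℕ (lo β)) (toℕ (hi β))) (sym p) (subst₂ (Edge _) (sym l) (sym h) e)
  spans-coloured {β = β} (backward l h) p e =
    subst (λ z → Edge z (toℕ (lo β)) (toℕ (hi β))) (sym p) (subst₂ (Edge _) (sym l) (sym h) (edge-sym e))

  -- The t-th edge of colour c is {c + (t+1), c + far t}; the offsets t+1
  -- and far t = 2k - t lie in (0, M) and add up to M.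
  far : ℕ → ℕ
  far t = k + (k ∸ t)

  near<M : ∀ {t} → t < k → suc t < M
  near<M t<k = s≤s (≤-trans t<k (m≤m+n k k))

  far<M : ∀ t → far t < M
  far<M t = s≤s (+-monoʳ-≤ k (m∸n≤m k t))

  -- All near offsets lie below all far offsets (both are ≤ k resp. > k).
  near<far : ∀ {t t′} → t < k → t′ < k → suc t < far t′
  near<far t<k t′<k = ≤-<-trans t<k (m<m+n k (m<n⇒0<n∸m t′<k))

  near+far : ∀ {t} → t < k → suc t + far t ≡ M
  near+far {t} t<k = cong suc (begin
    t + (k + (k ∸ t)) ≡⟨ left-comm t k (k ∸ t) ⟩
    k + (t + (k ∸ t)) ≡⟨ cong (k +_) (m+[n∸m]≡n (<⇒≤ t<k)) ⟩
    k + k             ∎)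
    where
    open ≡-Reasoning
    left-comm : ∀ a b c → a + (b + c) ≡ b + (a + c)
    left-comm = solve-∀

  module ColourClasses (v : ℕ) {n : ℕ} (M≤n : M ≤ n) where

    Colour : Set
    Colour = Fin (v ⊓ M)

    point : Colour → Fin v
    point c = fromℕ< (m<n⊓o⇒m<n v M (toℕ<n c))

    colour<M : (c : Colour) → toℕ c < M
    colour<M c = m<n⊓o⇒m<o v M (toℕ<n c)

    point-injective : ∀ {c c′ : Colour} {β γ : Block n v} →
      toℕ (pt β) ≡ toℕ c → toℕ (pt γ) ≡ toℕ c′ → β ≡ γ → c ≡ c′
    point-injective pβ pγ refl = toℕ-injective (trans (sym pβ) pγ)

    nearEnd farEnd : Colour → ℕ → ℕ
    nearEnd c t = (toℕ c + suc t) % M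
    farEnd  c t = (toℕ c + far t) % M

    mod-M<n : ∀ x → x % M < n
    mod-M<n x = <-≤-trans (m%n<n x M) M≤n

    near≢far : ∀ c {t t′} → t < k → t′ < k → nearEnd c t ≢ farEnd c t′
    near≢far c {t′ = t′} t<k t′<k eq =
      <-irrefl (translate-cancel (toℕ c) (near<M t<k) (far<M t′) eq) (near<far t<k t′<k)

    class-edge : ∀ c {t} → t < k → Edge (toℕ c) (nearEnd c t) (farEnd c t)
    class-edge c {t} t<k =
      finite (colour<M c) (m%n<n (x + suc t) M) (m%n<n (x + far t) M) (near≢far c t<k t<k) sum
      where
      open ≡-Reasoning
      x = toℕ c
      interchange : ∀ a b p q → a + b + (p + q) ≡ a + p + (b + q)
      interchange = solve-∀
      sum : (nearEnd c t + farEnd c t) % M ≡ (x + x) % M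
      sum = begin
        ((x + suc t) % M + (x + far t) % M) % M ≡⟨ %-distribˡ-+ (x + suc t) (x + far t) M ⟨
        (x + suc t + (x + far t)) % M           ≡⟨ cong (_% M) (interchange x (suc t) x (far t)) ⟩
        (x + x + (suc t + far t)) % M           ≡⟨ cong (λ z → (x + x + z) % M) (near+far t<k) ⟩
        (x + x + M) % M                         ≡⟨ [m+n]%n≡m%n (x + x) M ⟩
        (x + x) % M                             ∎

    classBlock : Colour → (t : ℕ) → t < k → Block n v
    classBlock c t t<k = pairBlock (nearEnd c t) (farEnd c t)
      (mod-M<n (toℕ c + suc t)) (mod-M<n (toℕ c + far t)) (near≢far c t<k t<k) (point c)

    classBlock-spec : ∀ c t (t<k : t < k) →
      Spans (classBlock c t t<k) (nearEnd c t) (farEnd c t) × pt (classBlock c t t<k) ≡ point c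
    classBlock-spec c t t<k = pairBlock-spec (nearEnd c t) (farEnd c t)
      (mod-M<n (toℕ c + suc t)) (mod-M<n (toℕ c + far t)) (near≢far c t<k t<k) (point c)

    classBlock-spans : ∀ c t (t<k : t < k) → Spans (classBlock c t t<k) (nearEnd c t) (farEnd c t)
    classBlock-spans c t t<k = proj₁ (classBlock-spec c t t<k)

    classBlock-point : ∀ c t (t<k : t < k) → toℕ (pt (classBlock c t t<k)) ≡ toℕ c
    classBlock-point c t t<k = trans (cong toℕ (proj₂ (classBlock-spec c t t<k))) (toℕ-fromℕ< _)

    classBlock-coloured : ∀ c t (t<k : t < k) → Coloured (classBlock c t t<k)
    classBlock-coloured c t t<k =
      spans-coloured (classBlock-spans c t t<k) (classBlock-point c t t<k) (class-edge c t<k)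

    -- Distinct (colour, index) pairs give distinct blocks: the near end of
    -- the t-th edge is the near end of the t′-th edge only if t ≡ t′, and it
    -- is never a far end.
    classBlock-injective : ∀ {c c′ t t′} (t<k : t < k) (t′<k : t′ < k) →
      classBlock c t t<k ≡ classBlock c′ t′ t′<k → c ≡ c′ × t ≡ t′
    classBlock-injective {c} {c′} {t} {t′} t<k t′<k e
      with refl ← point-injective (classBlock-point c t t<k) (classBlock-point c′ t′ t′<k) e
      with spans-shared (subst (λ β → Spans β (nearEnd c t) (farEnd c t)) e (classBlock-spans c t t<k))
                        (classBlock-spans c t′ t′<k)
    ... | inj₁ near≡near = refl , suc-injective (translate-cancel (toℕ c) (near<M t<k) (near<M t′<k) near≡near)
    ... | inj₂ near≡far  = ⊥-elim (near≢far c t<k t′<k near≡far)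

  odd-packing : ∀ v → Packing M v ((v ⊓ M) * k)
  odd-packing v = family-packing (v ⊓ M) k family family-injective family-coloured
    where
    open ColourClasses v ≤-refl
    family : Colour × Fin k → Block M v
    family (c , t) = classBlock c (toℕ t) (toℕ<n t)
    family-injective : ∀ {i j} → family i ≡ family j → i ≡ j
    family-injective {c , t} {c′ , t′} e
      with refl , t≡t′ ← classBlock-injective {c} {c′} (toℕ<n t) (toℕ<n t′) e
      = cong (c ,_) (toℕ-injective t≡t′)
    family-coloured : ∀ i → Coloured (family i)
    family-coloured (c , t) = classBlock-coloured c (toℕ t) (toℕ<n t)

  even-packing : ∀ v → Packing (suc M) v ((v ⊓ M) * suc k)
  even-packing v = family-packing (v ⊓ M) (suc k) family family-injective family-coloured
    where
    open ColourClasses v (n≤1+n M)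

    M≢colour : ∀ c → M ≢ toℕ c
    M≢colour c M≡c = <-irrefl (sym M≡c) (colour<M c)

    infinityBlock : Colour → Block (suc M) v
    infinityBlock c =
      pairBlock M (toℕ c) (n<1+n M) (m<n⇒m<1+n (colour<M c)) (M≢colour c) (point c)

    infinityBlock-spec : ∀ c →
      Spans (infinityBlock c) M (toℕ c) × pt (infinityBlock c) ≡ point c
    infinityBlock-spec c =
      pairBlock-spec M (toℕ c) (n<1+n M) (m<n⇒m<1+n (colour<M c)) (M≢colour c) (point c)

    infinityBlock-point : ∀ c → toℕ (pt (infinityBlock c)) ≡ toℕ c
    infinityBlock-point c = trans (cong toℕ (proj₂ (infinityBlock-spec c))) (toℕ-fromℕ< _)

    infinity∉class : ∀ {c c′ t} (t<k : t < k) → infinityBlock c ≢ classBlock c′ t t<k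
    infinity∉class {c} {c′} {t} t<k e
      with spans-shared (subst (λ β → Spans β M (toℕ c)) e (proj₁ (infinityBlock-spec c)))
                        (classBlock-spans c′ t t<k)
    ... | inj₁ M≡near = <-irrefl (sym M≡near) (m%n<n (toℕ c′ + suc t) M)
    ... | inj₂ M≡far  = <-irrefl (sym M≡far) (m%n<n (toℕ c′ + far t) M)

    family : Colour × Fin (suc k) → Block (suc M) v
    family (c , Fin.zero)  = infinityBlock c
    family (c , Fin.suc t) = classBlock c (toℕ t) (toℕ<n t)

    family-injective : ∀ {i j} → family i ≡ family j → i ≡ j
    family-injective {c , Fin.zero} {c′ , Fin.zero} e =
      cong (_, Fin.zero) (point-injective (infinityBlock-point c) (infinityBlock-point c′) e)
    family-injective {c , Fin.zero} {c′ , Fin.suc t′} e = ⊥-elim (infinity∉class {c} {c′} (toℕ<n t′) e)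
    family-injective {c , Fin.suc t} {c′ , Fin.zero} e = ⊥-elim (infinity∉class {c′} {c} (toℕ<n t) (sym e))
    family-injective {c , Fin.suc t} {c′ , Fin.suc t′} e
      with refl , t≡t′ ← classBlock-injective {c} {c′} (toℕ<n t) (toℕ<n t′) e
      = cong (λ z → c , Fin.suc z) (toℕ-injective t≡t′)

    family-coloured : ∀ i → Coloured (family i)
    family-coloured (c , Fin.zero) =
      spans-coloured (proj₁ (infinityBlock-spec c)) (infinityBlock-point c) fromInfinity
    family-coloured (c , Fin.suc t) = classBlock-coloured c (toℕ t) (toℕ<n t)

choose2-step : ∀ m → suc (suc m) C 2 ≡ suc m + (suc m C 2)
choose2-step m =
  trans (sym (nCk+nC[k+1]≡[n+1]C[k+1] (suc m) 1)) (cong (_+ (suc m C 2)) (nC1≡n (suc m)))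

twice-choose2 : ∀ m → (suc m C 2) * 2 ≡ suc m * m
twice-choose2 zero    = refl
twice-choose2 (suc m) = begin
  (suc (suc m) C 2) * 2         ≡⟨ cong (_* 2) (choose2-step m) ⟩
  (suc m + (suc m C 2)) * 2     ≡⟨ *-distribʳ-+ 2 (suc m) (suc m C 2) ⟩
  suc m * 2 + (suc m C 2) * 2   ≡⟨ cong (suc m * 2 +_) (twice-choose2 m) ⟩
  suc m * 2 + suc m * m         ≡⟨ collect m ⟩
  suc (suc m) * suc m           ∎
  where
  open ≡-Reasoning
  collect : ∀ m → suc m * 2 + suc m * m ≡ suc (suc m) * suc m
  collect = solve-∀

choose2-odd : ∀ k → (suc (k + k) C 2) ≡ suc (k + k) * k
choose2-odd k = *-cancelʳ-≡ _ _ 2 (trans (twice-choose2 (k + k)) (regroup k))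
  where
  regroup : ∀ k → suc (k + k) * (k + k) ≡ suc (k + k) * k * 2
  regroup = solve-∀

choose2-even : ∀ k → (suc (suc (k + k)) C 2) ≡ suc (k + k) * suc k
choose2-even k = *-cancelʳ-≡ _ _ 2 (trans (twice-choose2 (suc (k + k))) (regroup k))
  where
  regroup : ∀ k → suc (suc (k + k)) * suc (k + k) ≡ suc (k + k) * suc k * 2
  regroup = solve-∀

[r+[k+k]]/2≡k : ∀ r k → r < 2 → (r + (k + k)) / 2 ≡ k
[r+[k+k]]/2≡k r k r<2 = begin
  (r + (k + k)) / 2 ≡⟨ cong (λ z → (r + z) / 2) (twice k) ⟩
  (r + k * 2) / 2   ≡⟨ +-distrib-/-∣ʳ r (divides-refl k) ⟩
  r / 2 + k * 2 / 2 ≡⟨ cong₂ _+_ (m<n⇒m/n≡0 r<2) (m*n/n≡m k 2) ⟩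
  k                 ∎
  where
  open ≡-Reasoning
  twice : ∀ k → k + k ≡ k * 2
  twice = solve-∀

half-odd : ∀ k → suc (k + k) / 2 ≡ k
half-odd k = [r+[k+k]]/2≡k 1 k (s≤s (s≤s z≤n))

half-even : ∀ k → suc (suc (k + k)) / 2 ≡ suc k
half-even k = trans (m/n≡1+[m∸n]/n {suc (suc (k + k))} (s≤s (s≤s z≤n))) (cong suc ([r+[k+k]]/2≡k 0 k (s≤s z≤n)))

packing-size : ∀ n v M s → (n C 2) ≡ M * s → n / 2 ≡ s →
  (v ⊓ M) * s ≡ (n C 2) ⊓ (v * (n / 2))
packing-size n v M s pairs half = begin
  (v ⊓ M) * s              ≡⟨ *-distribʳ-⊓ s v M ⟩
  (v * s) ⊓ (M * s)        ≡⟨ ⊓-comm (v * s) (M * s) ⟩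
  (M * s) ⊓ (v * s)        ≡⟨ cong₂ _⊓_ (sym pairs) (cong (v *_) (sym half)) ⟩
  (n C 2) ⊓ (v * (n / 2))  ∎
  where open ≡-Reasoning

data Parity : ℕ → Set where
  odd  : ∀ k → Parity (suc (k + k))
  even : ∀ k → Parity (suc (suc (k + k)))

parity : ∀ n → Parity (suc n)
parity zero = odd zero
parity (suc n) with parity n
... | odd k  = even k
... | even k = subst Parity (cong (suc ∘ suc) (+-suc k k)) (odd (suc k))

proposition4p1 : (v₁ v₂ : ℕ) → v₁ ≥ 2 → v₂ ≥ 1 →
    Σ (List (Block v₁ v₂)) λ P →
      IsGeneralizedPacking P × (length P ≡ (v₁ C 2) ⊓ (v₂ * (v₁ / 2)))
proposition4p1 (suc n) v₂ (s≤s _) _ with parity n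
... | odd k  = subst (Packing (suc (k + k)) v₂)
  (packing-size (suc (k + k)) v₂ (suc (k + k)) k (choose2-odd k) (half-odd k))
  (RoundRobin.odd-packing k v₂)
... | even k = subst (Packing (suc (suc (k + k))) v₂)
  (packing-size (suc (suc (k + k))) v₂ (suc (k + k)) (suc k) (choose2-even k) (half-even k))
  (RoundRobin.even-packing k v₂)
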